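{- Let $G$ be a vertex-transitive group of automorphisms of a connected $d$-valent graph $\Gamma$, and let $\alpha$ be a $G$-consistent walk. Then $\delta(G) \leq d + \delta(G_\alpha)$. In particular, if $\Gamma$ contains a $G$-consistent cycle $\alpha$ such that $G_\alpha = 1$, then $\delta(G) \leq d$.
   Context: All graphs are finite and simple with at least three vertices. $\delta(K)$ denotes the size of a smallest generating set of a group $K$. Automorphisms act on the right and act on tuples of vertices coordinatewise; $G_\alpha$ is the subgroup of $G$ fixing every vertex of $\alpha$. A walk of length $n \geq 1$ is a tuple $(v_0, \ldots, v_n)$ of vertices with consecutive vertices adjacent; it is $G$-consistent if there is $g \in G$ with $v_i^g = v_{i+1}$ for all $i \in \{0, \ldots, n-1\}$. A cycle is a walk $(v_0, \ldots, v_n)$ with $v_0 = v_n$ and $v_0, \ldots, v_{n-1}$ pairwise distinct. -}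

module Defs where

open import Data.Nat using (ℕ; zero; suc; _+_; _≤_)
import Data.Fin
open import Data.Fin using (Fin; inject₁) renaming (suc to fsuc)
open import Data.Fin.Permutation using (Permutation′; _⟨$⟩ʳ_; _≈_; id; flip; _∘ₚ_)
open import Data.List using (List; length; filter; allFin)
open import Data.List.Membership.Propositional using (_∈_)
open import Data.List.Relation.Unary.All using (All)
open import Data.Vec using (Vec; lookup)
open import Data.Product using (Σ; ∃; _×_; _,_)
open import Relation.Binary.PropositionalEquality using (_≡_)
open import Relation.Binary.Construct.Closure.ReflexiveTransitive using (Star)
open import Relation.Nullary using (Dec; ¬_)
open import Function.Bundles using (_⇔_)

record Graph (n : ℕ) : Set₁ where
  field
    three≤n : 3 ≤ n
    Adj     : Fin n → Fin n → Set
    adj?    : ∀ u v → Dec (Adj u v)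
    sym     : ∀ {u v} → Adj u v → Adj v u
    irrefl  : ∀ {u} → ¬ Adj u u

-- Permutations of Fin n act on the right: v ^ g = g ⟨$⟩ʳ v, and
-- g ∘ₚ h means "first g, then h", so v ^ (g ∘ₚ h) = (v ^ g) ^ h.
Perm : ℕ → Set
Perm = Permutation′

_^_ : ∀ {n} → Fin n → Perm n → Fin n
v ^ g = g ⟨$⟩ʳ v

Pred : ℕ → Set₁
Pred n = Perm n → Set

record IsSubgroup {n : ℕ} (H : Pred n) : Set where
  field
    resp  : ∀ {g h} → g ≈ h → H g → H h
    idIn  : H id
    mulIn : ∀ {g h} → H g → H h → H (g ∘ₚ h)
    invIn : ∀ {g} → H g → H (flip g)

data Gen {n : ℕ} (S : List (Perm n)) : Perm n → Set where
  gen-id  : Gen S id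
  gen-el  : ∀ {g} → g ∈ S → Gen S g
  gen-mul : ∀ {g h} → Gen S g → Gen S h → Gen S (g ∘ₚ h)
  gen-inv : ∀ {g} → Gen S g → Gen S (flip g)
  gen-resp : ∀ {g h} → g ≈ h → Gen S g → Gen S h

IsGenSet : ∀ {n} → Pred n → List (Perm n) → Set
IsGenSet H S = All H S × (∀ g → H g → Gen S g)

δ-is : ∀ {n} → Pred n → ℕ → Set
δ-is H k = (∃ λ S → length S ≡ k × IsGenSet H S)
         × (∀ S → IsGenSet H S → k ≤ length S)

module _ {n : ℕ} (Γ : Graph n) where
  open Graph Γ

  IsAut : Perm n → Set
  IsAut g = ∀ u v → Adj u v ⇔ Adj (u ^ g) (v ^ g)

  IsAutGroup : Pred n → Set
  IsAutGroup G = IsSubgroup G × (∀ g → G g → IsAut g)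

  VertexTransitive : Pred n → Set
  VertexTransitive G = ∀ u v → ∃ λ g → G g × (u ^ g ≡ v)

  Connected : Set
  Connected = ∀ u v → Star Adj u v

  neighbours : Fin n → List (Fin n)
  neighbours v = filter (adj? v) (allFin n)

  Valent : ℕ → Set
  Valent d = ∀ v → length (neighbours v) ≡ d

  IsWalk : ∀ {len} → Vec (Fin n) (suc len) → Set
  IsWalk {len} w = 1 ≤ len × (∀ (i : Fin len) → Adj (lookup w (inject₁ i)) (lookup w (fsuc i)))

  IsCycle : ∀ {len} → Vec (Fin n) (suc len) → Set
  IsCycle {len} w = IsWalk w
    × lookup w Data.Fin.zero ≡ lookup w (Data.Fin.fromℕ len)
    × (∀ (i j : Fin len) → lookup w (inject₁ i) ≡ lookup w (inject₁ j) → i ≡ j)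

  GConsistent : Pred n → ∀ {len} → Vec (Fin n) (suc len) → Set
  GConsistent G {len} w = ∃ λ g → G g × (∀ (i : Fin len) → lookup w (inject₁ i) ^ g ≡ lookup w (fsuc i))

Stab : ∀ {n len} → Pred n → Vec (Fin n) len → Pred n
Stab G α g = G g × (∀ i → lookup α i ^ g ≡ lookup α i)

{-# OPTIONS --safe #-}
-- Let g witness the consistency of the walk, v i = v₀ gⁱ its vertices, A j the pointwise
-- stabiliser of v 0, …, v (j-1) in G (so A (len+1) = G_α) and R j the A j-orbit of v j.
-- Starting from g and a generating set S of G_α, descend through j = len, …, 0: while some
-- point of R j (for j = 0: some neighbour of v₀) is outside the orbit of v j under ⟨T⟩ ∩ A j,
-- add an element of A j mapping v j there; once none is left, A (j+1) ⊆ ⟨T⟩ gives A j ⊆ ⟨T⟩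
-- (for j = 0 by connectivity).  Conjugation by g maps A (j+1) into A j, so before anything is
-- added the orbit at level j already has |R (j+1)| points.  Level j therefore costs at most
-- |R j| - |R (j+1)| generators and level 0 at most d - |R 1|; the sum telescopes to at most
-- d - 1, which together with g gives δ(G) ≤ d + |S|.
-- Orbit membership is not decidable, so the construction runs in the double-negation monad;
-- this is harmless because the conclusion k ≤ d + m is decidable.
module Submission where

open import Defs
open import Level using (0ℓ)
open import Data.Nat using (ℕ; zero; suc; _+_; _≤_; _<_; _≤?_; z≤n; s≤s)
open import Data.Nat.Properties
  using (≤-refl; ≤-trans; ≤-reflexive; +-suc; +-comm; +-identityʳ; +-monoʳ-≤; m≤m+n; 1+n≰n;
         suc-injective; m<1+n⇒m<n∨m≡n; +-commutativeSemigroup; module ≤-Reasoning)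
open import Algebra.Properties.CommutativeSemigroup +-commutativeSemigroup using (x∙yz≈y∙xz)
open import Data.Fin using (Fin; toℕ; inject₁) renaming (zero to fzero; suc to fsuc)
open import Data.Fin.Properties using (toℕ-inject₁; toℕ<n)
open import Data.Fin.Permutation using (_≈_; id; flip; _∘ₚ_; _⟨$⟩ˡ_; inverseˡ; inverseʳ)
open import Data.Vec using (Vec; lookup)
open import Data.List using (List; []; _∷_; _++_; [_]; length; map)
open import Data.List.Properties using (length-++; length-map; length-removeAt′; length-tabulate)
open import Data.List.Membership.Propositional using (_∈_; _─_)
open import Data.List.Membership.Propositional.Properties using (∈-allFin; ∈-filter⁺)
open import Data.List.Relation.Unary.Any using (here; there; index)
open import Data.List.Relation.Unary.All using (All; []; _∷_)
import Data.List.Relation.Unary.All as All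
import Data.List.Relation.Unary.All.Properties as All
open import Data.List.Relation.Unary.AllPairs using ([]; _∷_)
open import Data.List.Relation.Unary.Unique.Propositional using (Unique)
import Data.List.Relation.Unary.Unique.Propositional.Properties as Unique
open import Data.List.Relation.Binary.Subset.Propositional using () renaming (_⊆_ to _⊆ᴸ_)
open import Data.List.Relation.Binary.Subset.Propositional.Properties
  using (xs⊆x∷xs; xs⊆ys++xs; ⊆-reflexive-↭)
open import Data.List.Relation.Binary.Permutation.Propositional.Properties using (shift)
open import Data.Product using (∃; ∃₂; _×_; _,_; proj₁; proj₂)
import Data.Product as Product
open import Data.Sum using (_⊎_; inj₁; inj₂)
open import Effect.Monad using (RawMonad)
open import Relation.Unary using (_⊆_; _∩_)
open import Relation.Nullary using (yes; no; ¬_)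
open import Relation.Nullary.Negation using (¬¬-Monad; contradiction)
open import Relation.Nullary.Decidable using (¬¬-excluded-middle; decidable-stable)
open import Relation.Binary.PropositionalEquality
  using (_≡_; _≢_; refl; sym; trans; cong; subst; subst₂; module ≡-Reasoning)
open import Relation.Binary.Construct.Closure.ReflexiveTransitive using (Star; ε; _◅_)
open import Function.Bundles using (Equivalence)

open RawMonad (¬¬-Monad {0ℓ}) using (pure; _>>=_)

¬¬-shift : ∀ {n} {P : Fin n → Set} → (∀ i → ¬ ¬ P i) → ¬ ¬ (∀ i → P i)
¬¬-shift {zero}  _   = pure λ ()
¬¬-shift {suc n} ¬¬P = do
  p₀ ← ¬¬P fzero
  ps ← ¬¬-shift (λ i → ¬¬P (fsuc i))
  pure λ { fzero → p₀ ; (fsuc i) → ps i }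

¬¬-⊆⊎∃∉ : ∀ {n} {P Q : Fin n → Set} → ¬ ¬ (P ⊆ Q ⊎ ∃ λ i → P i × ¬ Q i)
¬¬-⊆⊎∃∉ {P = P} {Q} = ¬¬-excluded-middle >>= λ where
  (yes escape) → pure (inj₂ escape)
  (no ∄escape) → do
    P⊆Q ← ¬¬-shift (λ i ¬P⇒Q → ¬P⇒Q λ Pi → contradiction (i , Pi , λ Qi → ¬P⇒Q λ _ → Qi) ∄escape)
    pure (inj₁ λ {i} → P⊆Q i)

module _ {A : Set} where

  ∈-─ : ∀ {x y : A} {ys} (x∈ys : x ∈ ys) → y ∈ ys → y ≢ x → y ∈ ys ─ x∈ys
  ∈-─ (here refl) (here refl) y≢x = contradiction refl y≢x
  ∈-─ (here refl) (there y∈ys) _  = y∈ys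
  ∈-─ (there _)   (here refl)  _  = here refl
  ∈-─ (there x∈ys) (there y∈ys) y≢x = there (∈-─ x∈ys y∈ys y≢x)

  unique-⊆⇒length≤ : ∀ {xs ys : List A} → Unique xs → xs ⊆ᴸ ys → length xs ≤ length ys
  unique-⊆⇒length≤ {[]} _ _ = z≤n
  unique-⊆⇒length≤ {x ∷ xs} {ys} (x∉xs ∷ xs!) x∷xs⊆ys = begin
    suc (length xs)          ≤⟨ s≤s (unique-⊆⇒length≤ xs! xs⊆ys─x) ⟩
    suc (length (ys ─ x∈ys)) ≡⟨ length-removeAt′ ys (index x∈ys) ⟨
    length ys                ∎
    where
    open ≤-Reasoning
    x∈ys = x∷xs⊆ys (here refl)
    xs⊆ys─x : xs ⊆ᴸ ys ─ x∈ys
    xs⊆ys─x y∈xs = ∈-─ x∈ys (x∷xs⊆ys (there y∈xs)) λ y≡x → All.lookup x∉xs y∈xs (sym y≡x)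

unique⇒length≤ : ∀ {n} {xs : List (Fin n)} → Unique xs → length xs ≤ n
unique⇒length≤ {n} xs! =
  ≤-trans (unique-⊆⇒length≤ xs! (λ {x} _ → ∈-allFin x))
          (≤-reflexive (length-tabulate (λ (i : Fin n) → i)))

module _ {n : ℕ} where

  Fix : Fin n → Pred n
  Fix x h = x ^ h ≡ x

  Orbit : Pred n → Fin n → Fin n → Set
  Orbit K x u = ∃ λ h → K h × x ^ h ≡ u

  Orbit-mono : ∀ {K K′ : Pred n} {x} → K ⊆ K′ → Orbit K x ⊆ Orbit K′ x
  Orbit-mono K⊆K′ (h , h∈K , x^h≡u) = h , K⊆K′ h∈K , x^h≡u

  ^-flip : ∀ {x y : Fin n} {g} → x ^ g ≡ y → y ^ flip g ≡ x
  ^-flip {g = g} x^g≡y = trans (cong (g ⟨$⟩ˡ_) (sym x^g≡y)) (inverseˡ g)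

  ^-injective : ∀ {x y : Fin n} g → x ^ g ≡ y ^ g → x ≡ y
  ^-injective {x} {y} g x^g≡y^g = trans (sym (^-flip {g = g} refl)) (^-flip {g = g} (sym x^g≡y^g))

  Fix-isSubgroup : ∀ x → IsSubgroup (Fix x)
  Fix-isSubgroup x = record
    { resp  = λ g≈h x^g≡x → trans (sym (g≈h x)) x^g≡x
    ; idIn  = refl
    ; mulIn = λ {g} {h} x^g≡x x^h≡x → trans (cong (_^ h) x^g≡x) x^h≡x
    ; invIn = λ {g} → ^-flip {g = g}
    }

  ∩-isSubgroup : ∀ {H K : Pred n} → IsSubgroup H → IsSubgroup K → IsSubgroup (H ∩ K)
  ∩-isSubgroup H-sub K-sub = record
    { resp  = λ g≈h → Product.map (H.resp g≈h) (K.resp g≈h)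
    ; idIn  = H.idIn , K.idIn
    ; mulIn = λ (g∈H , g∈K) (h∈H , h∈K) → H.mulIn g∈H h∈H , K.mulIn g∈K h∈K
    ; invIn = Product.map H.invIn K.invIn
    }
    where
    module H = IsSubgroup H-sub
    module K = IsSubgroup K-sub

  Gen-isSubgroup : ∀ (T : List (Perm n)) → IsSubgroup (Gen T)
  Gen-isSubgroup T = record
    { resp = gen-resp ; idIn = gen-id ; mulIn = gen-mul ; invIn = gen-inv }

  Gen-mono : ∀ {T T′ : List (Perm n)} → T ⊆ᴸ T′ → Gen T ⊆ Gen T′
  Gen-mono T⊆T′ gen-id                = gen-id
  Gen-mono T⊆T′ (gen-el t∈T)          = gen-el (T⊆T′ t∈T)
  Gen-mono T⊆T′ (gen-mul g∈⟨T⟩ h∈⟨T⟩)  = gen-mul (Gen-mono T⊆T′ g∈⟨T⟩) (Gen-mono T⊆T′ h∈⟨T⟩)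
  Gen-mono T⊆T′ (gen-inv g∈⟨T⟩)        = gen-inv (Gen-mono T⊆T′ g∈⟨T⟩)
  Gen-mono T⊆T′ (gen-resp g≈h g∈⟨T⟩)   = gen-resp g≈h (Gen-mono T⊆T′ g∈⟨T⟩)

  -- h = (h t⁻¹) t, where t ∈ ⟨T⟩ ∩ H moves x to x^h, so that h t⁻¹ fixes x.
  stabiliser∧orbit⇒⊆Gen : ∀ {H : Pred n} {x T} → IsSubgroup H → H ∩ Fix x ⊆ Gen T
    → Orbit H x ⊆ Orbit (Gen T ∩ H) x → H ⊆ Gen T
  stabiliser∧orbit⇒⊆Gen H-sub Hₓ⊆⟨T⟩ orbit {h} h∈H with orbit (h , h∈H , refl)
  ... | t , (t∈⟨T⟩ , t∈H) , x^t≡x^h =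
    gen-resp (λ _ → inverseʳ t)
      (gen-mul (Hₓ⊆⟨T⟩ (mulIn h∈H (invIn t∈H) , ^-flip {g = t} x^t≡x^h)) t∈⟨T⟩)
    where open IsSubgroup H-sub

module OrbitExtension {n} {H : Pred n} (H-sub : IsSubgroup H) (x : Fin n) {W : Fin n → Set}
  (W⊆xᴴ : W ⊆ Orbit H x)
  (W-spans : ∀ T → W ⊆ Orbit (Gen T ∩ H) x → Orbit H x ⊆ Orbit (Gen T ∩ H) x) where

  Extension : List (Perm n) → ℕ → Set
  Extension T m = ∃₂ λ E ys → All H E × H ⊆ Gen (E ++ T)
                            × Unique ys × All W ys × length E + m ≤ length ys

  private
    extend-within : ∀ fuel T → H ∩ Fix x ⊆ Gen T → ∀ {xs} → Unique xs
      → All (W ∩ Orbit (Gen T ∩ H) x) xs → n ≤ fuel + length xs → ¬ ¬ Extension T (length xs)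
    extend-within fuel T Hₓ⊆⟨T⟩ {xs} xs! xs⊆ n≤fuel+|xs| = ¬¬-⊆⊎∃∉ >>= spanned-or-escaped
      where
      spanned-or-escaped : W ⊆ Orbit (Gen T ∩ H) x ⊎ (∃ λ w → W w × ¬ Orbit (Gen T ∩ H) x w)
        → ¬ ¬ Extension T (length xs)
      spanned-or-escaped (inj₁ W⊆orbit) = pure
        ( [] , xs , [] , (λ {h} → stabiliser∧orbit⇒⊆Gen H-sub Hₓ⊆⟨T⟩ (W-spans T W⊆orbit))
        , xs! , All.map proj₁ xs⊆ , ≤-refl)
      spanned-or-escaped (inj₂ (w , w∈W , w∉orbit)) with W⊆xᴴ w∈W
      ... | h , h∈H , x^h≡w = continue fuel n≤fuel+|xs|
        where
        T⊆h∷T : T ⊆ᴸ h ∷ T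
        T⊆h∷T = xs⊆x∷xs T h
        w∷xs! : Unique (w ∷ xs)
        w∷xs! = All.map (λ (_ , y∈orbit) w≡y → w∉orbit (subst _ (sym w≡y) y∈orbit)) xs⊆ ∷ xs!
        w∷xs⊆ : All (W ∩ Orbit (Gen (h ∷ T) ∩ H) x) (w ∷ xs)
        w∷xs⊆ = (w∈W , h , (gen-el (here refl) , h∈H) , x^h≡w)
              ∷ All.map (Product.map₂ (Orbit-mono (Product.map₁ (Gen-mono T⊆h∷T)))) xs⊆
        continue : ∀ fuel → n ≤ fuel + length xs → ¬ ¬ Extension T (length xs)
        continue zero       n≤|xs|       = contradiction (≤-trans (unique⇒length≤ w∷xs!) n≤|xs|) 1+n≰n
        continue (suc fuel) n≤fuel+|xs| = do
          (E , ys , E⊆H , H⊆⟨E++h∷T⟩ , ys! , ys⊆W , |E|+|w∷xs|≤|ys|) ←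
            extend-within fuel (h ∷ T) (λ hₓ → Gen-mono T⊆h∷T (Hₓ⊆⟨T⟩ hₓ)) w∷xs! w∷xs⊆
              (subst (n ≤_) (sym (+-suc fuel _)) n≤fuel+|xs|)
          pure ( h ∷ E , ys , h∈H ∷ E⊆H
               , (λ {h′} h′∈H → Gen-mono (⊆-reflexive-↭ (shift h E T)) (H⊆⟨E++h∷T⟩ h′∈H))
               , ys! , ys⊆W , subst (_≤ length ys) (+-suc (length E) (length xs)) |E|+|w∷xs|≤|ys|)

  extend : ∀ T → H ∩ Fix x ⊆ Gen T → ∀ {xs} → Unique xs
    → All (W ∩ Orbit (Gen T ∩ H) x) xs → ¬ ¬ Extension T (length xs)
  -- Fuel n suffices: the points are distinct elements of Fin n.
  extend T Hₓ⊆⟨T⟩ xs! xs⊆ = extend-within n T Hₓ⊆⟨T⟩ xs! xs⊆ (m≤m+n n _)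

module _ {n} (Γ : Graph n) where
  open Graph Γ using (Adj; adj?)

  orbit-closed-under-Adj : ∀ {K : Pred n} {x u w} → IsSubgroup K → K ⊆ IsAut Γ
    → Adj x ⊆ Orbit K x → Orbit K x u → Adj u w → Orbit K x w
  orbit-closed-under-Adj {w = w} K-sub K⊆Aut Nₓ⊆orbit (k , k∈K , x^k≡u) u~w
    with Nₓ⊆orbit (subst (λ y → Adj y (w ^ flip k)) (^-flip {g = k} x^k≡u)
                     (Equivalence.to (K⊆Aut (IsSubgroup.invIn K-sub k∈K) _ w) u~w))
  ... | t , t∈K , x^t≡w^k⁻¹ =
    t ∘ₚ k , IsSubgroup.mulIn K-sub t∈K k∈K , trans (cong (_^ k) x^t≡w^k⁻¹) (inverseʳ k)

  neighbours⊆orbit⇒transitive : ∀ {K : Pred n} {x} → IsSubgroup K → K ⊆ IsAut Γ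
    → Adj x ⊆ Orbit K x → Connected Γ → ∀ u → Orbit K x u
  neighbours⊆orbit⇒transitive {K} {x} K-sub K⊆Aut Nₓ⊆orbit connected u =
    reach (id , IsSubgroup.idIn K-sub , refl) (connected x u)
    where
    reach : ∀ {y z} → Orbit K x y → Star Adj y z → Orbit K x z
    reach y∈orbit ε          = y∈orbit
    reach y∈orbit (y~y′ ◅ p) = reach (orbit-closed-under-Adj K-sub K⊆Aut Nₓ⊆orbit y∈orbit y~y′) p

  unique-neighbours≤valency : ∀ {d x ys} → Valent Γ d → Unique ys → All (Adj x) ys → length ys ≤ d
  unique-neighbours≤valency {x = x} {ys} valent ys! ys⊆Nₓ =
    subst (length ys ≤_) (valent x)
      (unique-⊆⇒length≤ ys! λ y∈ys → ∈-filter⁺ (adj? x) (∈-allFin _) (All.lookup ys⊆Nₓ y∈ys))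

module StabiliserChain {n} (Γ : Graph n) {G : Pred n} (G-sub : IsSubgroup G) (G⊆Aut : G ⊆ IsAut Γ)
  {g : Perm n} (g∈G : G g) (v₀ : Fin n) where

  open Graph Γ using (Adj)
  open IsSubgroup G-sub

  v : ℕ → Fin n
  v zero    = v₀
  v (suc i) = v i ^ g

  A : ℕ → Pred n
  A zero    = G
  A (suc j) = A j ∩ Fix (v j)

  R : ℕ → Fin n → Set
  R j = Orbit (A j) (v j)

  A-isSubgroup : ∀ j → IsSubgroup (A j)
  A-isSubgroup zero    = G-sub
  A-isSubgroup (suc j) = ∩-isSubgroup (A-isSubgroup j) (Fix-isSubgroup (v j))

  A⊆G : ∀ j → A j ⊆ G
  A⊆G zero    h∈G       = h∈G
  A⊆G (suc j) (h∈Aⱼ , _) = A⊆G j h∈Aⱼ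

  A-fix : ∀ {i j} → i < j → A j ⊆ Fix (v i)
  A-fix {i} {suc j} i<1+j (h∈Aⱼ , h-fixes-vⱼ) with m<1+n⇒m<n∨m≡n i<1+j
  ... | inj₁ i<j  = A-fix i<j h∈Aⱼ
  ... | inj₂ refl = h-fixes-vⱼ

  A-conjugate : ∀ j {a} → A (suc j) a → A j (g ∘ₚ a ∘ₚ flip g)
  A-conjugate zero    (a∈G , _)          = mulIn g∈G (mulIn a∈G (invIn g∈G))
  A-conjugate (suc j) (a∈A , a-fixes-vⱼ₊₁) = A-conjugate j a∈A , ^-flip {g = g} (sym a-fixes-vⱼ₊₁)

  -- Every generator beyond the first s is paid for by one of the points.
  record Stage (j : ℕ) (W : Fin n → Set) (s : ℕ) : Set where
    field
      gens      : List (Perm n)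
      gens⊆G    : All G gens
      g∈⟨gens⟩  : Gen gens g
      Aⱼ⊆⟨gens⟩ : A j ⊆ Gen gens
      points    : List (Fin n)
      points!   : Unique points
      points⊆W  : All W points
      size      : length gens ≤ s + length points

  initial-stage : ∀ j {S} → All G S → A j ⊆ Gen S → Stage j (R j) (length S)
  initial-stage j {S} S⊆G Aⱼ⊆⟨S⟩ = record
    { gens      = g ∷ S
    ; gens⊆G    = g∈G ∷ S⊆G
    ; g∈⟨gens⟩  = gen-el (here refl)
    ; Aⱼ⊆⟨gens⟩ = λ h∈Aⱼ → Gen-mono (xs⊆x∷xs S g) (Aⱼ⊆⟨S⟩ h∈Aⱼ)
    ; points    = [ v j ]
    ; points!   = [] ∷ []
    ; points⊆W  = (id , IsSubgroup.idIn (A-isSubgroup j) , refl) ∷ []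
    ; size      = ≤-reflexive (+-comm 1 (length S))
    }

  descend : ∀ {j W s} → W ⊆ R j
    → (∀ T → W ⊆ Orbit (Gen T ∩ A j) (v j) → R j ⊆ Orbit (Gen T ∩ A j) (v j))
    → (f : Fin n → Fin n) → (∀ {x y} → f x ≡ f y → x ≡ y)
    → (∀ {T} → Gen T g → A (suc j) ⊆ Gen T
         → ∀ {u} → R (suc j) u → (W ∩ Orbit (Gen T ∩ A j) (v j)) (f u))
    → Stage (suc j) (R (suc j)) s → ¬ ¬ Stage j W s
  descend {j} {W} {s} W⊆Rⱼ W-spans f f-injective f-maps stage = do
    (E , ys , E⊆Aⱼ , Aⱼ⊆⟨E++gens⟩ , ys! , ys⊆W , |E|+|f[points]|≤|ys|) ←
      extend gens Aⱼ₊₁⊆⟨gens⟩ (Unique.map⁺ f-injective points!)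
        (All.map⁺ (All.map (f-maps g∈⟨gens⟩ Aⱼ₊₁⊆⟨gens⟩) points⊆W))
    pure record
      { gens      = E ++ gens
      ; gens⊆G    = All.++⁺ (All.map (A⊆G j) E⊆Aⱼ) gens⊆G
      ; g∈⟨gens⟩  = Gen-mono (xs⊆ys++xs gens E) g∈⟨gens⟩
      ; Aⱼ⊆⟨gens⟩ = Aⱼ⊆⟨E++gens⟩
      ; points    = ys
      ; points!   = ys!
      ; points⊆W  = ys⊆W
      ; size      = begin
          length (E ++ gens)              ≡⟨ length-++ E ⟩
          length E + length gens          ≤⟨ +-monoʳ-≤ (length E) size ⟩
          length E + (s + length points)  ≡⟨ x∙yz≈y∙xz (length E) s (length points) ⟩
          s + (length E + length points)  ≡⟨ cong (λ m → s + (length E + m)) (length-map f points) ⟨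
          s + (length E + length (map f points)) ≤⟨ +-monoʳ-≤ s |E|+|f[points]|≤|ys| ⟩
          s + length ys                   ∎
      }
    where
    open Stage stage renaming (Aⱼ⊆⟨gens⟩ to Aⱼ₊₁⊆⟨gens⟩)
    open OrbitExtension (A-isSubgroup j) (v j) W⊆Rⱼ W-spans
    open ≤-Reasoning

  descend-orbit : ∀ {j s} → Stage (suc j) (R (suc j)) s → ¬ ¬ Stage j (R j) s
  descend-orbit {j} =
    descend (λ u∈Rⱼ → u∈Rⱼ) (λ _ Rⱼ⊆orbit → Rⱼ⊆orbit) (_^ flip g) (^-injective (flip g)) conjugate
    where
    conjugate : ∀ {T} → Gen T g → A (suc j) ⊆ Gen T → ∀ {u}
      → R (suc j) u → (R j ∩ Orbit (Gen T ∩ A j) (v j)) (u ^ flip g)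
    conjugate g∈⟨T⟩ Aⱼ₊₁⊆⟨T⟩ (a , a∈Aⱼ₊₁ , vⱼ₊₁^a≡u) = Orbit-mono proj₂ u^g⁻¹∈orbit , u^g⁻¹∈orbit
      where
      u^g⁻¹∈orbit = g ∘ₚ a ∘ₚ flip g
                  , (gen-mul g∈⟨T⟩ (gen-mul (Aⱼ₊₁⊆⟨T⟩ a∈Aⱼ₊₁) (gen-inv g∈⟨T⟩)) , A-conjugate j a∈Aⱼ₊₁)
                  , cong (_^ flip g) vⱼ₊₁^a≡u

  descend-to-neighbours : ∀ {s} → VertexTransitive Γ G → Connected Γ → Adj v₀ (v 1)
    → Stage 1 (R 1) s → ¬ ¬ Stage 0 (Adj v₀) s
  descend-to-neighbours transitive connected v₀~v₁ =
    descend (λ {u} _ → transitive v₀ u) spans (λ u → u) (λ u≡u′ → u≡u′) neighbour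
    where
    spans : ∀ T → Adj v₀ ⊆ Orbit (Gen T ∩ G) v₀ → R 0 ⊆ Orbit (Gen T ∩ G) v₀
    spans T Nᵥ₀⊆orbit {u} _ =
      neighbours⊆orbit⇒transitive Γ (∩-isSubgroup (Gen-isSubgroup T) G-sub)
        (λ (_ , h∈G) → G⊆Aut h∈G) Nᵥ₀⊆orbit connected u
    neighbour : ∀ {T} → Gen T g → A 1 ⊆ Gen T → ∀ {u} → R 1 u → (Adj v₀ ∩ Orbit (Gen T ∩ G) v₀) u
    neighbour g∈⟨T⟩ A₁⊆⟨T⟩ (a , a∈A₁@(a∈G , a-fixes-v₀) , v₁^a≡u) =
        subst₂ Adj a-fixes-v₀ v₁^a≡u (Equivalence.to (G⊆Aut a∈G v₀ (v 1)) v₀~v₁)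
      , g ∘ₚ a , (gen-mul g∈⟨T⟩ (A₁⊆⟨T⟩ a∈A₁) , mulIn g∈G a∈G) , v₁^a≡u

  descend-orbits : ∀ k {s} → Stage (suc k) (R (suc k)) s → ¬ ¬ Stage 1 (R 1) s
  descend-orbits zero    stage = pure stage
  descend-orbits (suc k) stage = descend-orbit stage >>= descend-orbits k

  Stage₀⇒generating-set : ∀ {d s} → Valent Γ d → Stage 0 (Adj v₀) s
    → ∃ λ T → IsGenSet G T × length T ≤ s + d
  Stage₀⇒generating-set {s = s} valent stage =
      gens , (gens⊆G , λ _ h∈G → Aⱼ⊆⟨gens⟩ h∈G)
    , ≤-trans size (+-monoʳ-≤ s (unique-neighbours≤valency Γ valent points! points⊆W))
    where open Stage stage

  generating-set : ∀ {d} len {S} → VertexTransitive Γ G → Connected Γ → Valent Γ d → Adj v₀ (v 1)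
    → All G S → A (suc len) ⊆ Gen S → ¬ ¬ ∃ λ T → IsGenSet G T × length T ≤ length S + d
  generating-set len transitive connected valent v₀~v₁ S⊆G Aₗₑₙ₊₁⊆⟨S⟩ = do
    stage₁ ← descend-orbits len (initial-stage (suc len) S⊆G Aₗₑₙ₊₁⊆⟨S⟩)
    stage₀ ← descend-to-neighbours transitive connected v₀~v₁ stage₁
    pure (Stage₀⇒generating-set valent stage₀)

  walk-vertices : ∀ {len} (α : Vec (Fin n) (suc len)) → lookup α fzero ≡ v₀
    → (∀ (i : Fin len) → lookup α (inject₁ i) ^ g ≡ lookup α (fsuc i))
    → ∀ i → lookup α i ≡ v (toℕ i)
  walk-vertices α α₀≡v₀ consistent i = vertex (toℕ i) refl
    where
    vertex : ∀ k {i} → toℕ i ≡ k → lookup α i ≡ v k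
    vertex zero    {fzero}  _  = α₀≡v₀
    vertex (suc k) {fsuc i} i+1≡k+1 =
      trans (sym (consistent i))
            (cong (_^ g) (vertex k (trans (toℕ-inject₁ i) (suc-injective i+1≡k+1))))

  A⊆Stab : ∀ {len} (α : Vec (Fin n) (suc len)) → (∀ i → lookup α i ≡ v (toℕ i))
    → A (suc len) ⊆ Stab G α
  A⊆Stab {len} α α≡v {h} h∈A = A⊆G (suc len) h∈A , λ i → begin
    lookup α i ^ h   ≡⟨ cong (_^ h) (α≡v i) ⟩
    v (toℕ i) ^ h    ≡⟨ A-fix (toℕ<n i) h∈A ⟩
    v (toℕ i)        ≡⟨ α≡v i ⟨
    lookup α i       ∎
    where open ≡-Reasoning

δ-trivial : ∀ {n} {H : Pred n} → (∀ h → H h → h ≈ id) → δ-is H 0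
δ-trivial H-trivial =
  ([] , refl , [] , λ h h∈H → gen-resp (λ i → sym (H-trivial h h∈H i)) gen-id) , λ _ _ → z≤n

δ≤valency+δ-stabiliser : ∀ {n} (Γ : Graph n) {G : Pred n} {d : ℕ}
  → IsAutGroup Γ G → VertexTransitive Γ G → Connected Γ → Valent Γ d
  → ∀ {len} (α : Vec (Fin n) (suc len)) → IsWalk Γ α → GConsistent Γ G α
  → ∀ k m → δ-is G k → δ-is (Stab G α) m → k ≤ d + m
δ≤valency+δ-stabiliser Γ _ _ _ _ {zero} _ (() , _)
δ≤valency+δ-stabiliser Γ {G} {d} (G-sub , G-aut) transitive connected valent {suc len} α
  (_ , α-adjacent) (g , g∈G , α-consistent) k m (_ , k-minimal) ((S , |S|≡m , S⊆Gα , Gα⊆⟨S⟩) , _) =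
  decidable-stable (k ≤? d + m) do
    (T , T-generates , |T|≤|S|+d) ← generating-set (suc len) transitive connected valent v₀~v₁
      (All.map proj₁ S⊆Gα) (λ h∈A → Gα⊆⟨S⟩ _ (A⊆Stab α (walk-vertices α refl α-consistent) h∈A))
    pure (begin
      k              ≤⟨ k-minimal T T-generates ⟩
      length T       ≤⟨ |T|≤|S|+d ⟩
      length S + d   ≡⟨ cong (_+ d) |S|≡m ⟩
      m + d          ≡⟨ +-comm m d ⟩
      d + m          ∎)
  where
  open Graph Γ using (Adj)
  open StabiliserChain Γ G-sub (λ {h} → G-aut h) g∈G (lookup α fzero)
  open ≤-Reasoning
  v₀~v₁ : Adj (lookup α fzero) (lookup α fzero ^ g)
  v₀~v₁ = subst (Adj _) (sym (α-consistent fzero)) (α-adjacent fzero)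

corollary7p4 : ∀ {n} (Γ : Graph n) (G : Pred n) (d : ℕ)
    → IsAutGroup Γ G → VertexTransitive Γ G → Connected Γ → Valent Γ d
    → (∀ {len} (α : Vec (Fin n) (suc len)) → IsWalk Γ α → GConsistent Γ G α
         → ∀ k m → δ-is G k → δ-is (Stab G α) m → k ≤ d + m)
    × (∀ {len} (α : Vec (Fin n) (suc len)) → IsCycle Γ α → GConsistent Γ G α
         → (∀ g → Stab G α g → g ≈ id)
         → ∀ k → δ-is G k → k ≤ d)
corollary7p4 Γ G d G-aut transitive connected valent =
    δ≤valency+δ-stabiliser Γ G-aut transitive connected valent
  , λ α (α-walk , _) α-consistent Gα-trivial k δ[G]≡k →
      subst (k ≤_) (+-identityʳ d)
        (δ≤valency+δ-stabiliser Γ G-aut transitive connected valent α α-walk α-consistent k 0 δ[G]≡k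
          (δ-trivial Gα-trivial))
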